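{- In the Littlestone construction described in the context, for every non-repetitive set $S_{\mathrm{nr}}\subseteq\mathcal{X}$, $$\mathrm{LS}(\mathcal{C}[S_{\mathrm{nr}}],\mathcal{Y})\le0.75rk+500k\sqrt{r}\log(|\mathcal{H}(S_{\mathrm{nr}})|+1).$$
   Context: Label Cover: $\mathcal{L}=(A,B,E,\Sigma,\{\pi_e\}_{e\in E})$, bipartite graph $(A,B,E)$, finite alphabet $\Sigma$, maps $\pi_{(a,b)}:\Sigma\to\Sigma$, bi-regular. A partial assignment defined on both endpoints of $(a,b)$ violates it if $\pi_{(a,b)}(\sigma(a))\ne\sigma(b)$. $\Sigma^V$ = functions $V\to\Sigma$. Littlestone construction: $n=|A|+|B|$, $r=\sqrt{n}/\log n$ (even), $U_1,\dots,U_r$ a partition of $A\cup B$ with $n/(2r)\le|U_i|\le2n/r$ and $|E|/(2r^2)\le|(U_i\times U_j)\cap E|,|(U_j\times U_i)\cap E|\le2|E|/r^2$; for $i\ne j$, $\mathcal{N}_i(j)\subseteq U_i$ are the vertices of $U_i$ with a neighbor in $U_j$, $\mathcal{N}_i(J)=\bigcup_{j\in J}\mathcal{N}_i(j)$. $k=10^{10}|E|\log|\Sigma|/r^2$. $\mathcal{U}=\mathcal{X}\cup\mathcal{Y}$, $\mathcal{X}=\{x_{i,\sigma_i,j}:i\in[r],\sigma_i\in\Sigma^{U_i},j\in[k]\}$, $\mathcal{Y}=\{y_{I,i,j}:I\subseteq[r]\times[k],i\in[r],j\in[k]\}$. $\ell=1000$. For each $\tilde H\subseteq[r]$, pick $\ell$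 random permutations of $[r]$, each giving the perfect matching pairing positions $2m-1,2m$; $M_{\tilde H}(i)$ is the set of indices matched with $i$, $T_{\tilde H}=\bigcup_i\mathcal{N}_i(M_{\tilde H}(i))$. $\tau(H)=\{i\in[r]:|\{j:(i,j)\in H\}|\ge k/2\}$. For every $I,H\subseteq[r]\times[k]$ and $\sigma\in\Sigma^{T_{\tau(H)}}$ violating no edge inside $T_{\tau(H)}$, concept $C_{I,H,\sigma}$ contains $x_{i,\sigma_i,j}$ iff $(i,j)\in I$ and $\sigma_i,\sigma$ agree on $\mathcal{N}_i(M_{\tau(H)}(i))$, and contains $y_{I',i,j}$ iff $(i,j)\in H$ and $I'=I$; $\mathcal{C}$ is the set of these concepts. $\mathcal{C}[S]=\{C\in\mathcal{C}:S\subseteq C\}$. Notation: $\mathcal{X}_i=\{x_{i,\sigma_i,j}\}$, $\mathcal{X}_{i,j}=\{x_{i,\sigma_i,j}:\sigma_i\in\Sigma^{U_i}\}$; $S\subseteq\mathcal{X}$ is non-repetitive if $|S\cap\mathcal{X}_{i,j}|\le1$ for all $(i,j)$. $S$ passes $\tilde H\subseteq[r]$ if (i) for every $i$, all $x_{i,\sigma_i,j},x_{i,\sigma'_i,j'}\in S$ have $\sigma_i,\sigma'_i$ agreeing on $T_{\tilde H}\cap U_i$, and (ii) the induced assignment on $T_{\tilde H}\cap\bigcup_{i:S\cap\mathcal{X}_i\ne\emptyset}U_i$ violates no edge with both endpoints in that set; $\mathcal{H}(S)$ is the collection of $\tilde H$ passed by $S$. $\mathrm{LS}(\mathcal{C}',\mathcal{U}')$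 (concepts intersected with $\mathcal{U}'$) is the maximum $d$ such that a full binary tree of depth $d$ with internal nodes $s\in\{0,1\}^{<d}$ labeled by $v_s\in\mathcal{U}'$ exists in which each leaf $\ell'$ has $C\in\mathcal{C}'$ with $v_{\ell'_{\le i}}\in C\iff\ell'_{i+1}=1$ for all $i<d$. Logarithms base 2. -}

module Defs where

open import Data.Nat using (ℕ; zero; suc; _+_; _*_; _∸_; _^_; _≤_; _<_; _≤ᵇ_)
open import Data.Nat.Properties using ()
open import Data.Bool using (Bool; true; false; if_then_else_)
open import Data.Fin using (Fin; toℕ; _≟_)
open import Data.Fin.Subset using (Subset; inside; outside; ∣_∣) renaming (_∈_ to _∈ˢ_)
open import Data.Fin.Permutation using (Permutation′; _⟨$⟩ʳ_)
open import Data.Vec using (Vec; lookup; tabulate)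
open import Data.List using (List)
open import Data.List.Membership.Propositional using (_∈_)
open import Data.Sum using (_⊎_; inj₁; inj₂)
open import Data.Product using (Σ; ∃; _×_; _,_)
open import Data.Empty using (⊥)
open import Data.Unit using (⊤)
open import Data.Nat.DivMod using (_/_)
open import Relation.Nullary using (¬_; does)
open import Relation.Binary.PropositionalEquality using (_≡_; _≢_)

∑ : ∀ {n} → (Fin n → ℕ) → ℕ
∑ {zero}  f = 0
∑ {suc n} f = f Fin.zero + ∑ (λ i → f (Fin.suc i))

[_] : Bool → ℕ
[ true ]  = 1
[ false ] = 0

-- Label Cover instance  (A = Fin na, B = Fin nb, Σ = Fin s)

record LabelCover : Set where
  field
    na nb s : ℕ
    E  : Fin na → Fin nb → Bool
    π  : Fin na → Fin nb → Fin s → Fin s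

-- the constant 10^10 (abstract only to keep type checking fast)
abstract
  C₀ : ℕ
  C₀ = 10 ^ 10

  C₀-def : C₀ ≡ 10 ^ 10
  C₀-def = _≡_.refl

-- number of permutations per H̃
ℓ : ℕ
ℓ = 1000

record Construction : Set where
  field
    lc : LabelCover
  open LabelCover lc public
  field
    r k   : ℕ
    partA : Fin na → Fin r                 -- the partition U_1..U_r of A ∪ B
    partB : Fin nb → Fin r
    perms : Subset r → Fin ℓ → Permutation′ r

module Constr (c : Construction) where
  open Construction c public

  V : Set
  V = Fin na ⊎ Fin nb

  part : V → Fin r
  part (inj₁ a) = partA a
  part (inj₂ b) = partB b

  n : ℕ
  n = na + nb

  edges : ℕ
  edges = ∑ λ a → ∑ λ b → [ E a b ]

  degA : Fin na → ℕ
  degA a = ∑ λ b → [ E a b ]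

  degB : Fin nb → ℕ
  degB b = ∑ λ a → [ E a b ]

  sizeU : Fin r → ℕ
  sizeU i = (∑ λ a → [ does (partA a ≟ i) ]) + (∑ λ b → [ does (partB b ≟ i) ])

  edgesBetween : Fin r → Fin r → ℕ
  edgesBetween i j = ∑ λ a → ∑ λ b →
    [ E a b ] * ([ does (partA a ≟ i) ] * [ does (partB b ≟ j) ])

  adj : V → V → Set
  adj (inj₁ a) (inj₂ b) = E a b ≡ true
  adj (inj₂ b) (inj₁ a) = E a b ≡ true
  adj _ _ = ⊥

  -- i and j are matched by the perfect matching of permutation p
  -- (positions 2m-1, 2m of the sequence p are paired; 0-based: 2m, 2m+1)
  matchedBy : Permutation′ r → Fin r → Fin r → Set
  matchedBy p i j = (i ≢ j) × (toℕ (p ⟨$⟩ʳ i) / 2 ≡ toℕ (p ⟨$⟩ʳ j) / 2)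

  M : Subset r → Fin r → Fin r → Set
  M H̃ i j = ∃ λ (t : Fin ℓ) → matchedBy (perms H̃ t) i j

  -- v ∈ 𝒩_i(M_H̃(i)) for i = part v, i.e. v ∈ T_H̃
  inT : Subset r → V → Set
  inT H̃ v = ∃ λ w → adj v w × M H̃ (part v) (part w)

  -- subsets of [r] × [k]
  Idx : Set
  Idx = Vec (Subset k) r

  _∈ᴵ_ : Fin r × Fin k → Idx → Set
  (i , j) ∈ᴵ I = j ∈ˢ lookup I i

  τ : Idx → Subset r
  τ H = tabulate λ i → if k ≤ᵇ 2 * ∣ lookup H i ∣ then inside else outside

  -- elements of 𝒳: x_{i,σ_i,j}; σ_i ∈ Σ^{U_i} is represented by a total
  -- assignment V → Σ of which only the values on U_i are relevant.
  record XElem : Set where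
    constructor x
    field
      xi  : Fin r
      xσ  : V → Fin s
      xj  : Fin k

  record YElem : Set where
    constructor y
    field
      yI : Idx
      yi : Fin r
      yj : Fin k

  -- σ ∈ Σ^{T_{τ(H)}} (values outside T irrelevant) violating no edge inside T
  NoViolationIn : (V → Set) → (V → Fin s) → Set
  NoViolationIn P σ = ∀ a b → E a b ≡ true → P (inj₁ a) → P (inj₂ b) →
    π a b (σ (inj₁ a)) ≡ σ (inj₂ b)

  record Concept : Set where
    constructor C
    field
      cI : Idx
      cH : Idx
      cσ : V → Fin s
      valid : NoViolationIn (inT (τ cH)) cσ

  _∈ˣ_ : XElem → Concept → Set
  x i σi j ∈ˣ C I H σ _ =
    ((i , j) ∈ᴵ I) × (∀ v → part v ≡ i → inT (τ H) v → σi v ≡ σ v)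

  _∈ʸ_ : YElem → Concept → Set
  y I′ i j ∈ʸ C I H σ _ = ((i , j) ∈ᴵ H) × (I′ ≡ I)

  ConceptsContaining : List XElem → Concept → Set
  ConceptsContaining S c = ∀ e → e ∈ S → e ∈ˣ c

  -- S is non-repetitive: |S ∩ 𝒳_{i,j}| ≤ 1 (elements compared as x_{i,σ_i|U_i,j})
  NonRepetitive : List XElem → Set
  NonRepetitive S = ∀ i σ σ′ j → x i σ j ∈ S → x i σ′ j ∈ S →
    ∀ v → part v ≡ i → σ v ≡ σ′ v

  Passes : List XElem → Subset r → Set
  Passes S H̃ =
    (∀ i σ j σ′ j′ → x i σ j ∈ S → x i σ′ j′ ∈ S →
       ∀ v → part v ≡ i → inT H̃ v → σ v ≡ σ′ v)
    ×
    (∀ a b → E a b ≡ true →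
       ∀ i σ j i′ σ′ j′ → x i σ j ∈ S → x i′ σ′ j′ ∈ S →
       part (inj₁ a) ≡ i → part (inj₂ b) ≡ i′ →
       inT H̃ (inj₁ a) → inT H̃ (inj₂ b) →
       π a b (σ (inj₁ a)) ≡ σ′ (inj₂ b))

  record Valid : Set where
    field
      biregA     : ∃ λ d → ∀ a → degA a ≡ d
      biregB     : ∃ λ d → ∀ b → degB b ≡ d
      r-even     : ∃ λ m → r ≡ 2 * m
      r-pos      : 1 ≤ r
      U-lower    : ∀ i → n ≤ 2 * r * sizeU i
      U-upper    : ∀ i → r * sizeU i ≤ 2 * n
      E-lower    : ∀ i j → edges ≤ 2 * (r * r) * edgesBetween i j
      E-upper    : ∀ i j → (r * r) * edgesBetween i j ≤ 2 * edges
      -- k = ⌈10^10 |E| log₂|Σ| / r²⌉, i.e.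
      -- (k-1) r² < 10^10 |E| log₂ s ≤ k r²
      k-upper    : s ^ (C₀ * edges) ≤ 2 ^ (k * (r * r))
      k-lower    : 2 ^ ((k ∸ 1) * (r * r)) < s ^ (C₀ * edges)

data Tree (Y : Set) : ℕ → Set where
  leaf : Tree Y 0
  node : ∀ {d} → Y → (t₀ t₁ : Tree Y d) → Tree Y (suc d)

-- every leaf of the tree is realised by a concept satisfying P
-- (t₀: branch where the label is NOT in the concept, t₁: branch where it is)
Shatters : ∀ {Y Con : Set} → (Y → Con → Set) → (Con → Set) → ∀ {d} → Tree Y d → Set
Shatters mem P leaf = ∃ P
Shatters mem P (node v t₀ t₁) =
  Shatters mem (λ c → P c × ¬ mem v c) t₀ × Shatters mem (λ c → P c × mem v c) t₁

-- d ≤ 0.75 r k + 500 k √r log₂(h+1), encoded over ℕ: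
-- equivalently (4d - 3rk) ≤ 2000 k √r log₂(h+1); this holds iff for every
-- rational a/b (b ≥ 1) with a/b < (4d-3rk)/(2000 k √r) we have a/b ≤ log₂(h+1),
-- i.e. 2^a ≤ (h+1)^b.  (If 4d ≤ 3rk the premise is never satisfied.)

BoundLS : (r k h d : ℕ) → Set
BoundLS r k h d = ∀ a b → 1 ≤ b →
  (2000 * k * a) ^ 2 * r < (b * (4 * d ∸ 3 * r * k)) ^ 2 →
  2 ^ a ≤ (h + 1) ^ b

-- Below the root label y I₀ i₀ j₀ take its "in" branch: every concept there
-- has index I₀, so membership of a label y I₀ i j just says (i , j) ∈ H.  For
-- a guess s ⊆ [r], walk down that branch going "in" at y I₀ i j iff i ∈ s.  A
-- pair (i , j) cannot recur on the path (the branch contradicting its first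
-- visit would be empty), and the concept C I₀ H σ at the leaf contains the
-- visited pairs in rows i ∈ s and none of those in the other rows.  Measured against the threshold k/2 that
-- defines τ H, row i carries at most k/2 visited pairs unless s and τ H agree
-- at i, so 2(d - 1) ≤ rk + k·agree(s, τ H); and τ H ∈ 𝓗(S) since S ⊆ C I₀ H σ.
-- So every point of the cube {0,1}ʳ agrees in at least m places with a member
-- of 𝓗(S), where 2(d - 1) ≤ rk + km.  Summing the weight q^agree p^disagree
-- over the cube gives 2ʳ q^m p^(r-m) ≤ |𝓗(S)| (p + q)ʳ, and p = v - 1,
-- q = v + 1 with v ≈ 4√r turns this into 2^⌊(2m - r)/v⌋ ≤ 2|𝓗(S)|, which
-- rearranges to the bound.

module Submission where

open import Defs
open import Data.Bool using (Bool; true; false; not; _xor_; T; if_then_else_)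
open import Data.Empty using (⊥; ⊥-elim)
open import Data.Fin using (Fin; zero; suc)
open import Data.Fin.Properties using (nonZeroIndex)
open import Data.Fin.Subset using (Subset; inside; outside; ∣_∣; ∁; ⁅_⁆; _∪_; _⊆_; _∉_) renaming (_∈_ to _∈ˢ_; ⊥ to ∅)
open import Data.Fin.Subset.Properties using (_∈?_; ∣p∣≤n; ∣∁p∣≡n∸∣p∣; p⊆q⇒∣p∣≤∣q∣; p⊂q⇒∣p∣<∣q∣; p⊆p∪q; x∈p∪q⁺; x∈p∪q⁻; x∈⁅x⁆; x∈⁅y⁆⇒x≡y; x∈∁p⇒x∉p; x∉p⇒x∈∁p; ∉⊥)
open import Data.List using (List; []; _∷_; length; map)
open import Data.List.Membership.Propositional using (_∈_)
open import Data.List.Membership.Propositional.Properties using (∈-length)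
open import Data.List.Relation.Unary.Any using (here; there)
open import Data.List.Relation.Unary.Unique.Propositional using (Unique)
open import Data.Nat using (ℕ; zero; suc; _+_; _*_; _∸_; _^_; _≤_; _<_; _≤ᵇ_; _≤?_; _<?_; z≤n; s≤s; NonZero; >-nonZero⁻¹)
open import Data.Nat.DivMod using (_/_; _%_; m≡m%n+[m/n]*n; m%n<n)
open import Data.Nat.ListAction using (sum)
open import Data.Nat.Properties
open import Algebra.Properties.CommutativeSemigroup *-commutativeSemigroup
  using () renaming (x∙yz≈y∙xz to m*[n*o]≡n*[m*o]; xy∙z≈y∙xz to m*n*o≡n*[m*o])
open import Algebra.Properties.CommutativeSemigroup +-commutativeSemigroup
  using () renaming (interchange to [m+n]+[o+p]≡[m+o]+[n+p])
open import Data.Nat.Tactic.RingSolver using (solve-∀)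
open import Data.Product using (Σ; ∃; _×_; _,_; proj₁; proj₂)
open import Data.Sum using (inj₁; inj₂)
open import Data.Unit using (tt)
open import Data.Vec using (Vec; []; _∷_; lookup; updateAt; replicate)
import Data.Vec as Vec
open import Data.Vec.Properties using (lookup∘tabulate; lookup-replicate)
open import Function using (_∘_)
open import Relation.Binary.PropositionalEquality using (_≡_; refl; sym; trans; cong; cong₂; subst; subst₂)
open import Relation.Nullary using (¬_; yes; no)

open ≤-Reasoning

shatters⇒nonempty : ∀ {Y Con : Set} {mem : Y → Con → Set} {P : Con → Set} {d} (t : Tree Y d) →
                    Shatters mem P t → ∃ P
shatters⇒nonempty leaf           P≢∅       = P≢∅
shatters⇒nonempty (node v t₀ t₁) (sh₀ , _) with shatters⇒nonempty t₀ sh₀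
... | c , (Pc , _) = c , Pc

module _ {Y Con : Set} (mem : Y → Con → Set) where

  Realises : Bool → Y → Con → Set
  Realises true  v c = mem v c
  Realises false v c = ¬ mem v c

  realises-exclusive : ∀ b {v c} → Realises b v c → Realises (not b) v c → ⊥
  realises-exclusive true  v∈c v∉c = v∉c v∈c
  realises-exclusive false v∉c v∈c = v∉c v∈c

  subtree : ∀ {d} → Bool → Tree Y d → Tree Y d → Tree Y d
  subtree false t₀ _  = t₀
  subtree true  _  t₁ = t₁

  shatters-subtree : ∀ {P : Con → Set} {d v} {t₀ t₁ : Tree Y d} b → Shatters mem P (node v t₀ t₁) →
                     Shatters mem (λ c → P c × Realises b v c) (subtree b t₀ t₁)
  shatters-subtree false (sh₀ , _) = sh₀
  shatters-subtree true  (_ , sh₁) = sh₁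

agreements : ∀ {n} → Vec Bool n → Vec Bool n → ℕ
agreements []      []      = 0
agreements (a ∷ v) (b ∷ g) = [ not (a xor b) ] + agreements v g

agreements≤n : ∀ {n} (v g : Vec Bool n) → agreements v g ≤ n
agreements≤n []          []          = z≤n
agreements≤n (true  ∷ v) (true  ∷ g) = s≤s (agreements≤n v g)
agreements≤n (false ∷ v) (false ∷ g) = s≤s (agreements≤n v g)
agreements≤n (true  ∷ v) (false ∷ g) = m≤n⇒m≤1+n (agreements≤n v g)
agreements≤n (false ∷ v) (true  ∷ g) = m≤n⇒m≤1+n (agreements≤n v g)

∑ᶜ : ∀ {n} → (Vec Bool n → ℕ) → ℕ
∑ᶜ {zero}  f = f []
∑ᶜ {suc n} f = ∑ᶜ (f ∘ (true ∷_)) + ∑ᶜ (f ∘ (false ∷_))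

∑ᶜ-mono-≤ : ∀ {n} {f g : Vec Bool n → ℕ} → (∀ v → f v ≤ g v) → ∑ᶜ f ≤ ∑ᶜ g
∑ᶜ-mono-≤ {zero}  f≤g = f≤g []
∑ᶜ-mono-≤ {suc n} f≤g = +-mono-≤ (∑ᶜ-mono-≤ (f≤g ∘ (true ∷_))) (∑ᶜ-mono-≤ (f≤g ∘ (false ∷_)))

∑ᶜ-const : ∀ n c → ∑ᶜ {n} (λ _ → c) ≡ 2 ^ n * c
∑ᶜ-const zero    c = sym (+-identityʳ c)
∑ᶜ-const (suc n) c = begin-equality
  ∑ᶜ {n} (λ _ → c) + ∑ᶜ {n} (λ _ → c) ≡⟨ cong₂ _+_ (∑ᶜ-const n c) (∑ᶜ-const n c) ⟩
  2 ^ n * c + 2 ^ n * c               ≡⟨ cong (2 ^ n * c +_) (+-identityʳ _) ⟨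
  2 * (2 ^ n * c)                     ≡⟨ *-assoc 2 (2 ^ n) c ⟨
  2 * 2 ^ n * c                       ∎

∑ᶜ-+ : ∀ {n} (f g : Vec Bool n → ℕ) → ∑ᶜ (λ v → f v + g v) ≡ ∑ᶜ f + ∑ᶜ g
∑ᶜ-+ {zero}  f g = refl
∑ᶜ-+ {suc n} f g = begin-equality
  ∑ᶜ (λ v → f (true ∷ v) + g (true ∷ v)) + ∑ᶜ (λ v → f (false ∷ v) + g (false ∷ v))
    ≡⟨ cong₂ _+_ (∑ᶜ-+ (f ∘ (true ∷_)) (g ∘ (true ∷_))) (∑ᶜ-+ (f ∘ (false ∷_)) (g ∘ (false ∷_))) ⟩
  (f₁ + g₁) + (f₀ + g₀) ≡⟨ [m+n]+[o+p]≡[m+o]+[n+p] f₁ g₁ f₀ g₀ ⟩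
  (f₁ + f₀) + (g₁ + g₀) ∎
  where
  f₁ = ∑ᶜ (f ∘ (true ∷_)); f₀ = ∑ᶜ (f ∘ (false ∷_))
  g₁ = ∑ᶜ (g ∘ (true ∷_)); g₀ = ∑ᶜ (g ∘ (false ∷_))

∑ᶜ-*ˡ : ∀ {n} c (f : Vec Bool n → ℕ) → ∑ᶜ (λ v → c * f v) ≡ c * ∑ᶜ f
∑ᶜ-*ˡ {zero}  c f = refl
∑ᶜ-*ˡ {suc n} c f =
  trans (cong₂ _+_ (∑ᶜ-*ˡ c (f ∘ (true ∷_))) (∑ᶜ-*ˡ c (f ∘ (false ∷_)))) (sym (*-distribˡ-+ c _ _))

minimiser : ∀ {n} (f : Vec Bool n → ℕ) → Σ (Vec Bool n) λ v₀ → ∀ v → f v₀ ≤ f v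
minimiser {zero}  f = [] , λ { [] → ≤-refl }
minimiser {suc n} f with minimiser (f ∘ (true ∷_)) | minimiser (f ∘ (false ∷_))
... | v₁ , min₁ | v₀ , min₀ with ≤-total (f (true ∷ v₁)) (f (false ∷ v₀))
...   | inj₁ ≤₀ = true ∷ v₁ , λ { (true ∷ v) → min₁ v ; (false ∷ v) → ≤-trans ≤₀ (min₀ v) }
...   | inj₂ ≤₁ = false ∷ v₀ , λ { (true ∷ v) → ≤-trans ≤₁ (min₁ v) ; (false ∷ v) → min₀ v }

∈⇒≤sum∘map : ∀ {A : Set} (F : A → ℕ) {g gs} → g ∈ gs → F g ≤ sum (map F gs)
∈⇒≤sum∘map F (here refl) = m≤m+n _ _
∈⇒≤sum∘map F (there g∈gs) = ≤-trans (∈⇒≤sum∘map F g∈gs) (m≤n+m _ _)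

module Weight (p q : ℕ) where

  factor : Bool → ℕ
  factor true  = q
  factor false = p

  weight : ∀ {n} → Vec Bool n → Vec Bool n → ℕ
  weight []      []      = 1
  weight (a ∷ v) (b ∷ g) = factor (not (a xor b)) * weight v g

  ∑ᶜ-weight : ∀ {n} (g : Vec Bool n) → ∑ᶜ (λ v → weight v g) ≡ (p + q) ^ n
  ∑ᶜ-weight []              = refl
  ∑ᶜ-weight {suc n} (b ∷ g) = begin-equality
    ∑ᶜ (λ v → x₁ * weight v g) + ∑ᶜ (λ v → x₀ * weight v g)
      ≡⟨ cong₂ _+_ (∑ᶜ-*ˡ x₁ (λ v → weight v g)) (∑ᶜ-*ˡ x₀ (λ v → weight v g)) ⟩
    x₁ * ∑ᶜ (λ v → weight v g) + x₀ * ∑ᶜ (λ v → weight v g) ≡⟨ *-distribʳ-+ _ x₁ x₀ ⟨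
    (x₁ + x₀) * ∑ᶜ (λ v → weight v g)                       ≡⟨ cong₂ _*_ (factors b) (∑ᶜ-weight g) ⟩
    (p + q) * (p + q) ^ n                                     ∎
    where
    x₁ = factor (not (true xor b))
    x₀ = factor (not (false xor b))
    factors : ∀ b → factor (not (true xor b)) + factor (not (false xor b)) ≡ p + q
    factors true  = +-comm q p
    factors false = refl

  module _ (p≤q : p ≤ q) where

    p≤factor : ∀ a → p ≤ factor a
    p≤factor true  = p≤q
    p≤factor false = ≤-refl

    p^n≤weight : ∀ {n} (v g : Vec Bool n) → p ^ n ≤ weight v g
    p^n≤weight []      []      = ≤-refl
    p^n≤weight (a ∷ v) (b ∷ g) = *-mono-≤ (p≤factor (not (a xor b))) (p^n≤weight v g)

    weight-lower : ∀ {n} (v g : Vec Bool n) m → m ≤ agreements v g → q ^ m * p ^ (n ∸ m) ≤ weight v g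
    weight-lower-disagree : ∀ {n} (v g : Vec Bool n) m → m ≤ agreements v g →
                            q ^ m * p ^ (suc n ∸ m) ≤ p * weight v g

    weight-lower {n} v g zero _ = ≤-trans (≤-reflexive (*-identityˡ (p ^ n))) (p^n≤weight v g)
    weight-lower (true  ∷ v) (true  ∷ g) (suc m) (s≤s m≤) =
      ≤-trans (≤-reflexive (*-assoc q (q ^ m) _)) (*-monoʳ-≤ q (weight-lower v g m m≤))
    weight-lower (false ∷ v) (false ∷ g) (suc m) (s≤s m≤) =
      ≤-trans (≤-reflexive (*-assoc q (q ^ m) _)) (*-monoʳ-≤ q (weight-lower v g m m≤))
    weight-lower []          []          (suc m) ()
    weight-lower (true  ∷ v) (false ∷ g) m m≤ = weight-lower-disagree v g m m≤
    weight-lower (false ∷ v) (true  ∷ g) m m≤ = weight-lower-disagree v g m m≤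

    weight-lower-disagree {n} v g m m≤ = begin
      q ^ m * p ^ (suc n ∸ m)   ≡⟨ cong (λ e → q ^ m * p ^ e) (+-∸-assoc 1 (≤-trans m≤ (agreements≤n v g))) ⟩
      q ^ m * (p * p ^ (n ∸ m)) ≡⟨ m*[n*o]≡n*[m*o] (q ^ m) p _ ⟩
      p * (q ^ m * p ^ (n ∸ m)) ≤⟨ *-monoʳ-≤ p (weight-lower v g m m≤) ⟩
      p * weight v g            ∎

    covering-bound : ∀ {n} (Hs : List (Vec Bool n)) (G : Vec Bool n → Vec Bool n) →
                     (∀ v → G v ∈ Hs) → ∀ m → (∀ v → m ≤ agreements v (G v)) →
                     2 ^ n * (q ^ m * p ^ (n ∸ m)) ≤ length Hs * (p + q) ^ n
    covering-bound {n} Hs G G∈Hs m m≤ = begin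
      2 ^ n * (q ^ m * p ^ (n ∸ m))               ≡⟨ ∑ᶜ-const n (q ^ m * p ^ (n ∸ m)) ⟨
      ∑ᶜ {n} (λ _ → q ^ m * p ^ (n ∸ m))         ≤⟨ ∑ᶜ-mono-≤ (λ v → weight-lower v (G v) m (m≤ v)) ⟩
      ∑ᶜ (λ v → weight v (G v))                   ≤⟨ ∑ᶜ-mono-≤ (λ v → ∈⇒≤sum∘map (weight v) (G∈Hs v)) ⟩
      ∑ᶜ (λ v → sum (map (weight v) Hs))          ≡⟨ ∑ᶜ-sum-weight Hs ⟩
      length Hs * (p + q) ^ n                     ∎
      where
      ∑ᶜ-sum-weight : ∀ gs → ∑ᶜ (λ v → sum (map (weight v) gs)) ≡ length gs * (p + q) ^ n
      ∑ᶜ-sum-weight []       = trans (∑ᶜ-const n 0) (*-zeroʳ (2 ^ n))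
      ∑ᶜ-sum-weight (g ∷ gs) = trans (∑ᶜ-+ (λ v → weight v g) _)
                                     (cong₂ _+_ (∑ᶜ-weight g) (∑ᶜ-sum-weight gs))

^-distribʳ-* : ∀ m n o → (m * n) ^ o ≡ m ^ o * n ^ o
^-distribʳ-* m n zero    = refl
^-distribʳ-* m n (suc o) =
  trans (cong (m * n *_) (^-distribʳ-* m n o)) ([m*n]*[o*p]≡[m*o]*[n*p] m n (m ^ o) (n ^ o))

m*m<n*n⇒m<n : ∀ m n → m * m < n * n → m < n
m*m<n*n⇒m<n m n m²<n² with m <? n
... | yes m<n = m<n
... | no  m≮n = ⊥-elim (<⇒≱ m²<n² (*-mono-≤ (≮⇒≥ m≮n) (≮⇒≥ m≮n)))

integer-sqrt : ∀ r → Σ ℕ λ u → u * u ≤ r × r < suc u * suc u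
integer-sqrt zero    = 0 , z≤n , s≤s z≤n
integer-sqrt (suc r) with integer-sqrt r
... | u , u²≤r , r<[1+u]² with suc r <? suc u * suc u
...   | yes r+1<[1+u]² = u , m≤n⇒m≤1+n u²≤r , r+1<[1+u]²
...   | no  r+1≮[1+u]² = suc u , ≮⇒≥ r+1≮[1+u]² ,
                         ≤-<-trans r<[1+u]² (*-mono-< (n<1+n (suc u)) (n<1+n (suc u)))

[1-1/N]^t≥1-t/N : ∀ M t → t ≤ suc M → suc M ^ t * (suc M ∸ t) ≤ M ^ t * suc M
[1-1/N]^t≥1-t/N M zero    _         = ≤-refl
[1-1/N]^t≥1-t/N M (suc t) (s≤s t≤M) = begin
  suc M * suc M ^ t * (M ∸ t)    ≡⟨ m*n*o≡n*[m*o] (suc M) (suc M ^ t) (M ∸ t) ⟩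
  suc M ^ t * (suc M * (M ∸ t))  ≤⟨ *-monoʳ-≤ (suc M ^ t) step ⟩
  suc M ^ t * (M * suc (M ∸ t))  ≡⟨ m*[n*o]≡n*[m*o] (suc M ^ t) M (suc (M ∸ t)) ⟩
  M * (suc M ^ t * suc (M ∸ t))  ≡⟨ cong (λ e → M * (suc M ^ t * e)) (+-∸-assoc 1 t≤M) ⟨
  M * (suc M ^ t * (suc M ∸ t))  ≤⟨ *-monoʳ-≤ M ([1-1/N]^t≥1-t/N M t (m≤n⇒m≤1+n t≤M)) ⟩
  M * (M ^ t * suc M)            ≡⟨ *-assoc M (M ^ t) (suc M) ⟨
  M * M ^ t * suc M              ∎
  where
  [1+t+e]*e+t≡[t+e]*[1+e] : ∀ t e → suc (t + e) * e + t ≡ (t + e) * suc e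
  [1+t+e]*e+t≡[t+e]*[1+e] = solve-∀
  step : suc M * (M ∸ t) ≤ M * suc (M ∸ t)
  step = grow (m+[n∸m]≡n t≤M)
    where
    grow : ∀ {N e} → t + e ≡ N → suc N * e ≤ N * suc e
    grow {e = e} refl = ≤-trans (m≤m+n _ t) (≤-reflexive ([1+t+e]*e+t≡[t+e]*[1+e] t e))

[1+1/v]^n≥1+n/v : ∀ v n → v ^ n * (v + n) ≤ suc v ^ n * v
[1+1/v]^n≥1+n/v v zero    = ≤-reflexive (cong (1 *_) (+-identityʳ v))
[1+1/v]^n≥1+n/v v (suc n) = begin
  v * v ^ n * (v + suc n)    ≡⟨ m*n*o≡n*[m*o] v (v ^ n) (v + suc n) ⟩
  v ^ n * (v * (v + suc n))  ≤⟨ *-monoʳ-≤ (v ^ n) (≤-trans (m≤m+n _ n) (≤-reflexive (v*[v+1+n]+n≡[1+v]*[v+n] v n))) ⟩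
  v ^ n * (suc v * (v + n))  ≡⟨ m*[n*o]≡n*[m*o] (v ^ n) (suc v) (v + n) ⟩
  suc v * (v ^ n * (v + n))  ≤⟨ *-monoʳ-≤ (suc v) ([1+1/v]^n≥1+n/v v n) ⟩
  suc v * (suc v ^ n * v)    ≡⟨ *-assoc (suc v) (suc v ^ n) v ⟨
  suc v * suc v ^ n * v      ∎
  where
  v*[v+1+n]+n≡[1+v]*[v+n] : ∀ v n → v * (v + suc n) + n ≡ suc v * (v + n)
  v*[v+1+n]+n≡[1+v]*[v+n] = solve-∀

[1+1/v]^v≥2 : ∀ v .{{_ : NonZero v}} → 2 * v ^ v ≤ suc v ^ v
[1+1/v]^v≥2 v = *-cancelʳ-≤ (2 * v ^ v) (suc v ^ v) v (begin
  2 * v ^ v * v    ≡⟨ 2*x*v≡x*[v+v] (v ^ v) v ⟩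
  v ^ v * (v + v)  ≤⟨ [1+1/v]^n≥1+n/v v v ⟩
  suc v ^ v * v    ∎)
  where
  2*x*v≡x*[v+v] : ∀ x v → 2 * x * v ≡ x * (v + v)
  2*x*v≡x*[v+v] = solve-∀

[1+1/v]^δ≥2^[δ/v] : ∀ v .{{_ : NonZero v}} δ → 2 ^ (δ / v) * v ^ δ ≤ suc v ^ δ
[1+1/v]^δ≥2^[δ/v] v δ = begin
  2 ^ n * v ^ δ                 ≡⟨ cong (λ e → 2 ^ n * v ^ e) (m≡m%n+[m/n]*n δ v) ⟩
  2 ^ n * v ^ (ρ + n * v)       ≡⟨ cong (2 ^ n *_) (^-distribˡ-+-* v ρ (n * v)) ⟩
  2 ^ n * (v ^ ρ * v ^ (n * v)) ≡⟨ m*[n*o]≡n*[m*o] (2 ^ n) (v ^ ρ) _ ⟩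
  v ^ ρ * (2 ^ n * v ^ (n * v)) ≤⟨ *-mono-≤ (^-monoˡ-≤ ρ (n≤1+n v)) (blocks n) ⟩
  suc v ^ ρ * suc v ^ (n * v)   ≡⟨ ^-distribˡ-+-* (suc v) ρ (n * v) ⟨
  suc v ^ (ρ + n * v)           ≡⟨ cong (suc v ^_) (m≡m%n+[m/n]*n δ v) ⟨
  suc v ^ δ                     ∎
  where
  n = δ / v
  ρ = δ % v
  blocks : ∀ n → 2 ^ n * v ^ (n * v) ≤ suc v ^ (n * v)
  blocks zero    = ≤-refl
  blocks (suc n) = begin
    2 * 2 ^ n * v ^ (v + n * v)              ≡⟨ cong (2 * 2 ^ n *_) (^-distribˡ-+-* v v (n * v)) ⟩
    2 * 2 ^ n * (v ^ v * v ^ (n * v))        ≡⟨ [m*n]*[o*p]≡[m*o]*[n*p] 2 (2 ^ n) (v ^ v) _ ⟩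
    2 * v ^ v * (2 ^ n * v ^ (n * v))        ≤⟨ *-mono-≤ ([1+1/v]^v≥2 v) (blocks n) ⟩
    suc v ^ v * suc v ^ (n * v)              ≡⟨ ^-distribˡ-+-* (suc v) v (n * v) ⟨
    suc v ^ (v + n * v)                      ∎

[1+1/N]^t≤2 : ∀ M t → 2 * t ≤ suc M → suc M ^ t ≤ 2 * M ^ t
[1+1/N]^t≤2 M t 2t≤N = *-cancelʳ-≤ (suc M ^ t) (2 * M ^ t) (suc M) (begin
  suc M ^ t * suc M              ≤⟨ *-monoʳ-≤ (suc M ^ t) N≤2[N∸t] ⟩
  suc M ^ t * (2 * (suc M ∸ t))  ≡⟨ m*[n*o]≡n*[m*o] (suc M ^ t) 2 (suc M ∸ t) ⟩
  2 * (suc M ^ t * (suc M ∸ t))  ≤⟨ *-monoʳ-≤ 2 ([1-1/N]^t≥1-t/N M t t≤N) ⟩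
  2 * (M ^ t * suc M)            ≡⟨ *-assoc 2 (M ^ t) (suc M) ⟨
  2 * M ^ t * suc M              ∎)
  where
  t+t≤N : t + t ≤ suc M
  t+t≤N = subst (_≤ suc M) (cong (t +_) (+-identityʳ t)) 2t≤N
  t≤N : t ≤ suc M
  t≤N = m+n≤o⇒m≤o t t+t≤N
  N≤2[N∸t] : suc M ≤ 2 * (suc M ∸ t)
  N≤2[N∸t] = begin
    suc M                         ≡⟨ m∸n+n≡m t≤N ⟨
    (suc M ∸ t) + t               ≤⟨ +-monoʳ-≤ (suc M ∸ t) (m+n≤o⇒m≤o∸n t t+t≤N) ⟩
    (suc M ∸ t) + (suc M ∸ t)     ≡⟨ cong ((suc M ∸ t) +_) (+-identityʳ _) ⟨
    2 * (suc M ∸ t)               ∎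

-- (v - 1)(v + 1) = v² - 1, and (1 - 1/v²)ᵗ ≥ 1/2 because 2t ≤ v².
[1+1/v]^δ≤2h : ∀ w t δ h → 2 * t ≤ suc w * suc w →
               suc (suc w) ^ (t + δ) * w ^ t ≤ h * suc w ^ (t + (t + δ)) →
               suc (suc w) ^ δ ≤ 2 * h * suc w ^ δ
[1+1/v]^δ≤2h w t δ h 2t≤v² cover = *-cancelˡ-≤ (A * A) {{A*A≢0}} (begin
  A * A * B ^ δ                      ≡⟨ cong (_* B ^ δ) (^-distribʳ-* (suc w) (suc w) t) ⟨
  (suc w * suc w) ^ t * B ^ δ        ≤⟨ *-monoˡ-≤ (B ^ δ) ([1+1/N]^t≤2 (w + w * suc w) t 2t≤v²) ⟩
  2 * (w + w * suc w) ^ t * B ^ δ    ≡⟨ cong (λ x → 2 * x ^ t * B ^ δ) (*-suc w (suc w)) ⟨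
  2 * (w * B) ^ t * B ^ δ            ≡⟨ cong (λ x → 2 * x * B ^ δ) (^-distribʳ-* w B t) ⟩
  2 * (w ^ t * B ^ t) * B ^ δ        ≡⟨ 2*[x*y]*z≡2*[y*z*x] (w ^ t) (B ^ t) (B ^ δ) ⟩
  2 * (B ^ t * B ^ δ * w ^ t)        ≡⟨ cong (λ x → 2 * (x * w ^ t)) (^-distribˡ-+-* B t δ) ⟨
  2 * (B ^ (t + δ) * w ^ t)          ≤⟨ *-monoʳ-≤ 2 cover ⟩
  2 * (h * suc w ^ (t + (t + δ)))    ≡⟨ cong (λ x → 2 * (h * x)) (^-distribˡ-+-* (suc w) t (t + δ)) ⟩
  2 * (h * (A * suc w ^ (t + δ)))    ≡⟨ cong (λ x → 2 * (h * (A * x))) (^-distribˡ-+-* (suc w) t δ) ⟩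
  2 * (h * (A * (A * suc w ^ δ)))    ≡⟨ 2*[h*[a*[a*x]]]≡a*a*[2*h*x] h A (suc w ^ δ) ⟩
  A * A * (2 * h * suc w ^ δ)        ∎)
  where
  A = suc w ^ t
  B = suc (suc w)
  A*A≢0 : NonZero (A * A)
  A*A≢0 = m*n≢0 A A {{m^n≢0 (suc w) t}} {{m^n≢0 (suc w) t}}
  2*[x*y]*z≡2*[y*z*x] : ∀ x y z → 2 * (x * y) * z ≡ 2 * (y * z * x)
  2*[x*y]*z≡2*[y*z*x] = solve-∀
  2*[h*[a*[a*x]]]≡a*a*[2*h*x] : ∀ h a x → 2 * (h * (a * (a * x))) ≡ a * a * (2 * h * x)
  2*[h*[a*[a*x]]]≡a*a*[2*h*x] = solve-∀

a+b≤b*[δ/v] : ∀ a b u δ → b < a → 2000 * a * suc u < b * (δ + 4) →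
              a + b ≤ b * (δ / suc (4 * suc u))
a+b≤b*[δ/v] a b u δ b<a 2000au<b[δ+4] = begin
  a + b        ≤⟨ +-monoʳ-≤ a (<⇒≤ b<a) ⟩
  a + a        ≡⟨ cong (a +_) (+-identityʳ a) ⟨
  2 * a        ≤⟨ *-monoˡ-≤ a (m≤m+n 2 396) ⟩
  398 * a      <⟨ 398a<bn ⟩
  b * n        ∎
  where
  U = suc u
  v = suc (4 * U)
  n = δ / v
  δ+4≤[n+2]v : δ + 4 ≤ (n + 2) * v
  δ+4≤[n+2]v = begin
    δ + 4                     ≡⟨ cong (_+ 4) (m≡m%n+[m/n]*n δ v) ⟩
    δ % v + n * v + 4         ≡⟨ x+y+4≡y+[x+4] (δ % v) (n * v) ⟩
    n * v + (δ % v + 4)       ≤⟨ +-monoʳ-≤ (n * v) (+-mono-≤ (<⇒≤ (m%n<n δ v)) 4≤v) ⟩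
    n * v + (v + v)           ≡⟨ x*v+[v+v]≡[x+2]*v n v ⟩
    (n + 2) * v               ∎
    where
    4≤v : 4 ≤ v
    4≤v = ≤-trans (m≤m*n 4 U) (n≤1+n (4 * U))
    x+y+4≡y+[x+4] : ∀ x y → x + y + 4 ≡ y + (x + 4)
    x+y+4≡y+[x+4] = solve-∀
    x*v+[v+v]≡[x+2]*v : ∀ x v → x * v + (v + v) ≡ (x + 2) * v
    x*v+[v+v]≡[x+2]*v = solve-∀
  400a<b[n+2] : 400 * a < b * (n + 2)
  400a<b[n+2] = *-cancelʳ-< (5 * U) (400 * a) (b * (n + 2)) (begin-strict
    400 * a * (5 * U)     ≡⟨ 400*a*[5*U]≡2000*a*U a U ⟩
    2000 * a * U          <⟨ 2000au<b[δ+4] ⟩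
    b * (δ + 4)           ≤⟨ *-monoʳ-≤ b δ+4≤[n+2]v ⟩
    b * ((n + 2) * v)     ≤⟨ *-monoʳ-≤ b (*-monoʳ-≤ (n + 2) (+-monoˡ-≤ (4 * U) (s≤s z≤n))) ⟩
    b * ((n + 2) * (5 * U)) ≡⟨ *-assoc b (n + 2) (5 * U) ⟨
    b * (n + 2) * (5 * U) ∎)
    where
    400*a*[5*U]≡2000*a*U : ∀ a U → 400 * a * (5 * U) ≡ 2000 * a * U
    400*a*[5*U]≡2000*a*U = solve-∀
  398a<bn : 398 * a < b * n
  398a<bn = +-cancelʳ-< (2 * a) (398 * a) (b * n) (begin-strict
    398 * a + 2 * a   ≡⟨ 398*a+2*a≡400*a a ⟩
    400 * a           <⟨ 400a<b[n+2] ⟩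
    b * (n + 2)       ≡⟨ b*[n+2]≡b*n+2*b b n ⟩
    b * n + 2 * b     ≤⟨ +-monoʳ-≤ (b * n) (*-monoʳ-≤ 2 (<⇒≤ b<a)) ⟩
    b * n + 2 * a     ∎)
    where
    398*a+2*a≡400*a : ∀ a → 398 * a + 2 * a ≡ 400 * a
    398*a+2*a≡400*a = solve-∀
    b*[n+2]≡b*n+2*b : ∀ b n → b * (n + 2) ≡ b * n + 2 * b
    b*[n+2]≡b*n+2*b = solve-∀

2^a≤h^b : ∀ a b h n → 2 ^ n ≤ 2 * h → a + b ≤ b * n → 2 ^ a ≤ h ^ b
2^a≤h^b a b h n 2^n≤2h a+b≤bn = *-cancelʳ-≤ (2 ^ a) (h ^ b) (2 ^ b) {{m^n≢0 2 b}} (begin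
  2 ^ a * 2 ^ b    ≡⟨ ^-distribˡ-+-* 2 a b ⟨
  2 ^ (a + b)      ≤⟨ ^-monoʳ-≤ 2 a+b≤bn ⟩
  2 ^ (b * n)      ≡⟨ cong (2 ^_) (*-comm b n) ⟩
  2 ^ (n * b)      ≡⟨ ^-*-assoc 2 n b ⟨
  (2 ^ n) ^ b      ≤⟨ ^-monoˡ-≤ b 2^n≤2h ⟩
  (2 * h) ^ b      ≡⟨ ^-distribʳ-* 2 h b ⟩
  2 ^ b * h ^ b    ≡⟨ *-comm (2 ^ b) (h ^ b) ⟩
  h ^ b * 2 ^ b    ∎)

4*[1+d]∸3rk≤k*[δ+4] : ∀ {r k d m} → 1 ≤ k → 2 * d ≤ r * k + k * m →
           4 * suc d ∸ 3 * r * k ≤ k * ((2 * m ∸ r) + 4)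
4*[1+d]∸3rk≤k*[δ+4] {r} {k} {d} {m} k≥1 2d≤ = m≤n+o⇒m∸n≤o (4 * suc d) (3 * r * k) (begin
  4 * suc d                        ≡⟨ 4*[1+d]≡2*[2*d]+4 d ⟩
  2 * (2 * d) + 4                  ≤⟨ +-monoˡ-≤ 4 (*-monoʳ-≤ 2 2d≤) ⟩
  2 * (r * k + k * m) + 4          ≡⟨ 2*[r*k+k*m]+4≡2*r*k+k*[2*m]+4 r k m ⟩
  2 * r * k + k * (2 * m) + 4      ≤⟨ +-monoˡ-≤ 4 (+-monoʳ-≤ (2 * r * k) (*-monoʳ-≤ k 2m≤δ+r)) ⟩
  2 * r * k + k * (δ + r) + 4      ≡⟨ 2*r*k+k*[δ+r]+4≡3*r*k+[k*δ+4] r k δ ⟩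
  3 * r * k + (k * δ + 4)          ≤⟨ +-monoʳ-≤ (3 * r * k) (+-monoʳ-≤ (k * δ) (*-monoˡ-≤ 4 k≥1)) ⟩
  3 * r * k + (k * δ + k * 4)      ≡⟨ cong (3 * r * k +_) (*-distribˡ-+ k δ 4) ⟨
  3 * r * k + k * (δ + 4)          ∎)
  where
  δ = 2 * m ∸ r
  2m≤δ+r : 2 * m ≤ δ + r
  2m≤δ+r = subst (2 * m ≤_) (+-comm r δ) (m≤n+m∸n (2 * m) r)
  4*[1+d]≡2*[2*d]+4 : ∀ d → 4 * suc d ≡ 2 * (2 * d) + 4
  4*[1+d]≡2*[2*d]+4 = solve-∀
  2*[r*k+k*m]+4≡2*r*k+k*[2*m]+4 : ∀ r k m → 2 * (r * k + k * m) + 4 ≡ 2 * r * k + k * (2 * m) + 4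
  2*[r*k+k*m]+4≡2*r*k+k*[2*m]+4 = solve-∀
  2*r*k+k*[δ+r]+4≡3*r*k+[k*δ+4] : ∀ r k δ → 2 * r * k + k * (δ + r) + 4 ≡ 3 * r * k + (k * δ + 4)
  2*r*k+k*[δ+r]+4≡3*r*k+[k*δ+4] = solve-∀

2000au<bx : ∀ {r k a b u x} D → 1 ≤ k → u * u ≤ r → D ≤ k * x →
            (2000 * k * a) ^ 2 * r < (b * D) ^ 2 → 2000 * a * u < b * x
2000au<bx {r} {k@(suc _)} {a} {b} {u} {x} D _ u²≤r D≤kx premise =
  *-cancelˡ-< k (2000 * a * u) (b * x) (m*m<n*n⇒m<n (k * (2000 * a * u)) (k * (b * x)) (begin-strict
    k * (2000 * a * u) * (k * (2000 * a * u)) ≡⟨ lhs k a u ⟩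
    (2000 * k * a) ^ 2 * (u * u)              ≤⟨ *-monoʳ-≤ ((2000 * k * a) ^ 2) u²≤r ⟩
    (2000 * k * a) ^ 2 * r                    <⟨ premise ⟩
    (b * D) ^ 2                               ≤⟨ ^-monoˡ-≤ 2 (*-monoʳ-≤ b D≤kx) ⟩
    (b * (k * x)) ^ 2                         ≡⟨ rhs k b x ⟩
    k * (b * x) * (k * (b * x))               ∎))
  where
  lhs : ∀ k a u → k * (2000 * a * u) * (k * (2000 * a * u)) ≡ 2000 * k * a * (2000 * k * a * 1) * (u * u)
  lhs = solve-∀
  rhs : ∀ k b x → b * (k * x) * (b * (k * x) * 1) ≡ k * (b * x) * (k * (b * x))
  rhs = solve-∀

cover⇒[1+1/v]^δ≤2h : ∀ {r m h} w → (∀ p q → p ≤ q → 2 ^ r * (q ^ m * p ^ (r ∸ m)) ≤ h * (p + q) ^ r) →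
                    m ≤ r → r ≤ 2 * m → 2 * (r ∸ m) ≤ suc w * suc w →
                    suc (suc w) ^ (2 * m ∸ r) ≤ 2 * h * suc w ^ (2 * m ∸ r)
cover⇒[1+1/v]^δ≤2h {r} {m} {h} w cover m≤r r≤2m 2t≤v² =
  [1+1/v]^δ≤2h w t δ h 2t≤v²
    (subst₂ (λ m′ r′ → suc (suc w) ^ m′ * w ^ t ≤ h * suc w ^ r′) m≡t+δ r≡t+[t+δ] cover-at-w)
  where
  t = r ∸ m
  δ = 2 * m ∸ r
  t+m≡r : t + m ≡ r
  t+m≡r = m∸n+n≡m m≤r
  m≡t+δ : m ≡ t + δ
  m≡t+δ = sym (+-cancelʳ-≡ r (t + δ) m (begin-equality
    t + δ + r      ≡⟨ +-assoc t δ r ⟩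
    t + (δ + r)    ≡⟨ cong (t +_) (m∸n+n≡m r≤2m) ⟩
    t + 2 * m      ≡⟨ x+2*y≡x+y+y t m ⟩
    t + m + m      ≡⟨ cong (_+ m) t+m≡r ⟩
    r + m          ≡⟨ +-comm r m ⟩
    m + r          ∎))
    where
    x+2*y≡x+y+y : ∀ x y → x + 2 * y ≡ x + y + y
    x+2*y≡x+y+y = solve-∀
  r≡t+[t+δ] : r ≡ t + (t + δ)
  r≡t+[t+δ] = trans (sym t+m≡r) (cong (t +_) m≡t+δ)
  cover-at-w : suc (suc w) ^ m * w ^ t ≤ h * suc w ^ r
  cover-at-w = *-cancelˡ-≤ (2 ^ r) {{m^n≢0 2 r}} (begin
    2 ^ r * (suc (suc w) ^ m * w ^ t)  ≤⟨ cover w (suc (suc w)) (≤-trans (n≤1+n w) (n≤1+n (suc w))) ⟩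
    h * (w + suc (suc w)) ^ r          ≡⟨ cong (λ x → h * x ^ r) (x+[2+x]≡2*[1+x] w) ⟩
    h * (2 * suc w) ^ r                ≡⟨ cong (h *_) (^-distribʳ-* 2 (suc w) r) ⟩
    h * (2 ^ r * suc w ^ r)            ≡⟨ m*[n*o]≡n*[m*o] h (2 ^ r) (suc w ^ r) ⟩
    2 ^ r * (h * suc w ^ r)            ∎)
    where
    x+[2+x]≡2*[1+x] : ∀ x → x + suc (suc x) ≡ 2 * suc x
    x+[2+x]≡2*[1+x] = solve-∀

-- With u = ⌊√r⌋ and v = 4u + 1 we have 2(r - m) ≤ v², so the covering bound at
-- p = v - 1, q = v + 1 gives 2^⌊δ/v⌋ ≤ 2h for δ = 2m - r.
ls-bound : ∀ {r k h d m} → 1 ≤ r → 1 ≤ k → 1 ≤ h → m ≤ r → 2 * d ≤ r * k + k * m →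
           (∀ p q → p ≤ q → 2 ^ r * (q ^ m * p ^ (r ∸ m)) ≤ h * (p + q) ^ r) →
           BoundLS r k h (suc d)
ls-bound {r} {k} {h} {d} {m} r≥1 k≥1 h≥1 m≤r 2d≤ cover a b _ premise with a ≤? b | integer-sqrt r
... | yes a≤b | _ = ≤-trans (^-monoʳ-≤ 2 a≤b) (^-monoˡ-≤ b (+-monoˡ-≤ 1 h≥1))
... | no _    | zero , _ , r<1 = ⊥-elim (<⇒≱ r<1 r≥1)
... | no a≰b  | suc u , u²≤r , r<[1+u]² =
  ≤-trans (2^a≤h^b a b h (δ / v) 2^[δ/v]≤2h (a+b≤b*[δ/v] a b u δ b<a 2000au<b[δ+4])) (^-monoˡ-≤ b (m≤m+n h 1))
  where
  U = suc u
  δ = 2 * m ∸ r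
  w = 4 * U
  v = suc w
  b<a : b < a
  b<a = ≰⇒> a≰b
  2000au<b[δ+4] : 2000 * a * U < b * (δ + 4)
  2000au<b[δ+4] = 2000au<bx {r} {k} {a} {b} (4 * suc d ∸ 3 * r * k) k≥1 u²≤r
                    (4*[1+d]∸3rk≤k*[δ+4] {r} {k} {d} {m} k≥1 2d≤) premise
  r≤2m : r ≤ 2 * m
  r≤2m with r ≤? 2 * m
  ... | yes r≤2m = r≤2m
  ... | no  r≰2m = ⊥-elim (<⇒≱ 2000au<b[δ+4] (begin
    b * (δ + 4)        ≡⟨ cong (λ x → b * (x + 4)) (m≤n⇒m∸n≡0 (<⇒≤ (≰⇒> r≰2m))) ⟩
    b * 4              ≤⟨ *-monoˡ-≤ 4 (<⇒≤ b<a) ⟩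
    a * 4              ≤⟨ *-monoʳ-≤ a (*-monoʳ-≤ 4 (s≤s z≤n)) ⟩
    a * (4 * (500 * U)) ≡⟨ x*[4*[500*y]]≡2000*x*y a U ⟩
    2000 * a * U       ∎))
    where
    x*[4*[500*y]]≡2000*x*y : ∀ x y → x * (4 * (500 * y)) ≡ 2000 * x * y
    x*[4*[500*y]]≡2000*x*y = solve-∀
  2t≤v² : 2 * (r ∸ m) ≤ v * v
  2t≤v² = begin
    2 * (r ∸ m)        ≤⟨ *-monoʳ-≤ 2 (m∸n≤m r m) ⟩
    2 * r              ≤⟨ *-monoʳ-≤ 2 (<⇒≤ r<[1+u]²) ⟩
    2 * (suc U * suc U) ≤⟨ m≤m+n _ _ ⟩
    2 * (suc U * suc U) + (14 * (u * u) + 32 * u + 17) ≡⟨ square u ⟩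
    v * v              ∎
    where
    square : ∀ u → 2 * (suc (suc u) * suc (suc u)) + (14 * (u * u) + 32 * u + 17) ≡
                   suc (4 * suc u) * suc (4 * suc u)
    square = solve-∀
  2^[δ/v]≤2h : 2 ^ (δ / v) ≤ 2 * h
  2^[δ/v]≤2h = *-cancelʳ-≤ (2 ^ (δ / v)) (2 * h) (v ^ δ) {{m^n≢0 v δ}}
    (≤-trans ([1+1/v]^δ≥2^[δ/v] v δ) (cover⇒[1+1/v]^δ≤2h {r} {m} {h} w cover m≤r r≤2m 2t≤v²))

oriented : ∀ {k} → Bool → Subset k → Subset k
oriented true  h = h
oriented false h = ∁ h

-- Bit i of τ H is, definitionally, majority (lookup H i).
majority : ∀ {k} → Subset k → Bool
majority {k} h = if k ≤ᵇ 2 * ∣ h ∣ then inside else outside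

module _ {k : ℕ} where

  2x≤k+k*1 : ∀ x → x ≤ k → 2 * x ≤ k + k * 1
  2x≤k+k*1 x x≤k = subst (2 * x ≤_) (cong (k +_) (trans (+-identityʳ k) (sym (*-identityʳ k)))) (*-monoʳ-≤ 2 x≤k)
  2x≤k+k*0 : ∀ x → 2 * x ≤ k → 2 * x ≤ k + k * 0
  2x≤k+k*0 x 2x≤k = subst (2 * x ≤_) (sym (trans (cong (k +_) (*-zeroʳ k)) (+-identityʳ k))) 2x≤k

  2*∣oriented∣≤ : ∀ b (h : Subset k) → 2 * ∣ oriented b h ∣ ≤ k + k * [ not (b xor majority h) ]
  2*∣oriented∣≤ b h with k ≤ᵇ 2 * ∣ h ∣ in eq | b
  ... | true  | true  = 2x≤k+k*1 ∣ h ∣ (∣p∣≤n h)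
  ... | false | false = 2x≤k+k*1 ∣ ∁ h ∣ (∣p∣≤n (∁ h))
  ... | false | true  = 2x≤k+k*0 ∣ h ∣ (<⇒≤ (≰⇒> λ k≤2∣h∣ → subst T eq (≤⇒≤ᵇ k≤2∣h∣)))
  ... | true  | false = 2x≤k+k*0 ∣ ∁ h ∣ (begin
    2 * ∣ ∁ h ∣             ≡⟨ cong (2 *_) (∣∁p∣≡n∸∣p∣ h) ⟩
    2 * (k ∸ ∣ h ∣)         ≡⟨ cong ((k ∸ ∣ h ∣) +_) (+-identityʳ _) ⟩
    (k ∸ ∣ h ∣) + (k ∸ ∣ h ∣) ≤⟨ +-monoʳ-≤ (k ∸ ∣ h ∣) (m≤n+o⇒m∸n≤o k ∣ h ∣ k≤∣h∣+∣h∣) ⟩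
    (k ∸ ∣ h ∣) + ∣ h ∣     ≡⟨ m∸n+n≡m (∣p∣≤n h) ⟩
    k                       ∎)
    where
    k≤∣h∣+∣h∣ : k ≤ ∣ h ∣ + ∣ h ∣
    k≤∣h∣+∣h∣ = subst (k ≤_) (cong (∣ h ∣ +_) (+-identityʳ _)) (≤ᵇ⇒≤ k _ (subst T (sym eq) tt))

size : ∀ {k r} → Vec (Subset k) r → ℕ
size Q = Vec.sum (Vec.map ∣_∣ Q)

2*size≤ : ∀ {k r} (Q : Vec (Subset k) r) (s g : Vec Bool r) →
          (∀ i → 2 * ∣ lookup Q i ∣ ≤ k + k * [ not (lookup s i xor lookup g i) ]) →
          2 * size Q ≤ r * k + k * agreements s g
2*size≤         []      []      []      _    = z≤n
2*size≤ {k} {suc r} (q ∷ Q) (a ∷ s) (b ∷ g) rows = begin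
  2 * (∣ q ∣ + size Q)                               ≡⟨ *-distribˡ-+ 2 ∣ q ∣ (size Q) ⟩
  2 * ∣ q ∣ + 2 * size Q                             ≤⟨ +-mono-≤ (rows zero) (2*size≤ Q s g (rows ∘ suc)) ⟩
  (k + k * x) + (r * k + k * agreements s g)        ≡⟨ regroup k x r (agreements s g) ⟩
  suc r * k + k * (x + agreements s g)              ∎
  where
  x = [ not (a xor b) ]
  regroup : ∀ k x r A → (k + k * x) + (r * k + k * A) ≡ suc r * k + k * (x + A)
  regroup = solve-∀

size-updateAt-< : ∀ {k r} (Q : Vec (Subset k) r) i {f : Subset k → Subset k} →
                  ∣ lookup Q i ∣ < ∣ f (lookup Q i) ∣ → size Q < size (updateAt Q i f)
size-updateAt-< (q ∷ Q) zero    grows = +-monoˡ-< (size Q) grows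
size-updateAt-< (q ∷ Q) (suc i) grows = +-monoʳ-< ∣ q ∣ (size-updateAt-< Q i grows)

updateAt-preserves : ∀ {A : Set} {n} (P : Fin n → A → Set) (xs : Vec A n) i {f : A → A} →
                     (∀ j → P j (lookup xs j)) → P i (f (lookup xs i)) →
                     ∀ j → P j (lookup (updateAt xs i f) j)
updateAt-preserves P (x ∷ xs) zero    all Pi zero    = Pi
updateAt-preserves P (x ∷ xs) zero    all Pi (suc j) = all (suc j)
updateAt-preserves P (x ∷ xs) (suc i) all Pi zero    = all zero
updateAt-preserves P (x ∷ xs) (suc i) all Pi (suc j) =
  updateAt-preserves (P ∘ suc) xs i (all ∘ suc) Pi j

∪⁅⁆-⊆ : ∀ {k} {p q : Subset k} {j} → p ⊆ q → j ∈ˢ q → p ∪ ⁅ j ⁆ ⊆ q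
∪⁅⁆-⊆ {p = p} {j = j} p⊆q j∈q x∈ with x∈p∪q⁻ p ⁅ j ⁆ x∈
... | inj₁ x∈p = p⊆q x∈p
... | inj₂ x∈⁅j⁆ = subst (_∈ˢ _) (sym (x∈⁅y⁆⇒x≡y j x∈⁅j⁆)) j∈q

∣p∣<∣p∪⁅j⁆∣ : ∀ {k} {p : Subset k} {j} → j ∉ p → ∣ p ∣ < ∣ p ∪ ⁅ j ⁆ ∣
∣p∣<∣p∪⁅j⁆∣ {p = p} {j} j∉p = p⊂q⇒∣p∣<∣q∣ (p⊆p∪q ⁅ j ⁆ , j , x∈p∪q⁺ (inj₂ (x∈⁅x⁆ j)) , j∉p)

module Adversary (c : Construction) where
  open Constr c

  containing⇒passes : ∀ S C → ConceptsContaining S C → Passes S (τ (Concept.cH C))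
  containing⇒passes S (C I H σ σ-valid) S⊆C =
    (λ i σ′ j σ″ j′ x∈S x′∈S v v∈Uᵢ v∈T →
       trans (proj₂ (S⊆C _ x∈S) v v∈Uᵢ v∈T) (sym (proj₂ (S⊆C _ x′∈S) v v∈Uᵢ v∈T))) ,
    (λ a b ab∈E i σ′ j i′ σ″ j′ x∈S x′∈S a∈Uᵢ b∈Uᵢ′ a∈T b∈T →
       trans (cong (π a b) (proj₂ (S⊆C _ x∈S) (inj₁ a) a∈Uᵢ a∈T))
             (trans (σ-valid a b ab∈E a∈T b∈T) (sym (proj₂ (S⊆C _ x′∈S) (inj₂ b) b∈Uᵢ′ b∈T))))

  module Walk (s : Subset r) (I₀ : Idx) where

    -- Q holds the pairs visited so far.
    Consistent : Idx → Concept → Set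
    Consistent Q K = Concept.cI K ≡ I₀ × (∀ i → lookup Q i ⊆ oriented (lookup s i) (lookup (Concept.cH K) i))

    realises⇒oriented : ∀ b {i j K} → Concept.cI K ≡ I₀ →
                        Realises _∈ʸ_ b (y I₀ i j) K → j ∈ˢ oriented b (lookup (Concept.cH K) i)
    realises⇒oriented true  _   (j∈H , _) = j∈H
    realises⇒oriented false I≡I₀ y∉K      = x∉p⇒x∈∁p λ j∈H → y∉K (j∈H , sym I≡I₀)

    oriented⇒realises : ∀ b {i j K} → Concept.cI K ≡ I₀ →
                        j ∈ˢ oriented b (lookup (Concept.cH K) i) → Realises _∈ʸ_ b (y I₀ i j) K
    oriented⇒realises true  I≡I₀ j∈H  = j∈H , sym I≡I₀
    oriented⇒realises false _    j∈∁H = λ (j∈H , _) → x∈∁p⇒x∉p j∈∁H j∈H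

    walk : ∀ {d} (t : Tree YElem d) {P : Concept → Set} (Q : Idx) → Shatters _∈ʸ_ P t →
           (∀ {K} → P K → Consistent Q K) →
           Σ Concept λ K → P K × Σ Idx λ Q′ → Consistent Q′ K × d + size Q ≤ size Q′
    walk leaf Q (K , PK) consistent = K , PK , Q , consistent PK , ≤-refl
    -- The label has index I₀ because its "in" branch is realised.
    walk (node (y I i j) t₀ t₁) {P} Q sh consistent with shatters⇒nonempty t₁ (proj₂ sh)
    ... | K₁ , PK₁ , (_ , I≡I₁) with trans I≡I₁ (proj₁ (consistent PK₁))
    ...   | refl with j ∈? lookup Q i
    ...     | yes j∈Q = ⊥-elim (realises-exclusive _∈ʸ_ b
                          (oriented⇒realises b (proj₁ (consistent PK′)) (proj₂ (consistent PK′) i j∈Q)) K′-realises)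
      where
      b = lookup s i
      K′ = shatters⇒nonempty (subtree _∈ʸ_ (not b) t₀ t₁) (shatters-subtree _∈ʸ_ (not b) sh)
      PK′ = proj₁ (proj₂ K′)
      K′-realises = proj₂ (proj₂ K′)
    ...     | no j∉Q with walk (subtree _∈ʸ_ (lookup s i) t₀ t₁) (updateAt Q i (_∪ ⁅ j ⁆))
                             (shatters-subtree _∈ʸ_ (lookup s i) sh) consistent′
      where
      consistent′ : ∀ {K} → P K × Realises _∈ʸ_ (lookup s i) (y I₀ i j) K → Consistent (updateAt Q i (_∪ ⁅ j ⁆)) K
      consistent′ {K} (PK , realises) = proj₁ (consistent PK) ,
        updateAt-preserves (λ i′ q → q ⊆ oriented (lookup s i′) (lookup (Concept.cH K) i′)) Q i (proj₂ (consistent PK))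
          (∪⁅⁆-⊆ (proj₂ (consistent PK) i) (realises⇒oriented (lookup s i) (proj₁ (consistent PK)) realises))
    ...       | K , (PK , _) , Q′ , consistent-Q′ , d+size≤ =
                K , PK , Q′ , consistent-Q′ ,
                ≤-trans (≤-reflexive (sym (+-suc _ (size Q))))
                        (≤-trans (+-monoʳ-≤ _ (size-updateAt-< Q i (∣p∣<∣p∪⁅j⁆∣ j∉Q))) d+size≤)

  open Walk using (walk; Consistent)

  agreeing-member : (S : List XElem) (Hs : List (Subset r)) → (∀ H̃ → Passes S H̃ → H̃ ∈ Hs) →
              ∀ {d} (t : Tree YElem d) I₀ i₀ j₀ →
              Shatters _∈ʸ_ (λ K → ConceptsContaining S K × y I₀ i₀ j₀ ∈ʸ K) t →
              (s : Subset r) → Σ (Subset r) λ g → g ∈ Hs × 2 * d ≤ r * k + k * agreements s g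
  agreeing-member S Hs passes⇒∈ {d} t I₀ i₀ j₀ sh s
    with walk s I₀ t {λ K → ConceptsContaining S K × y I₀ i₀ j₀ ∈ʸ K} (replicate r ∅) sh
              (λ {K} → empty-consistent {K})
    where
    empty-consistent : ∀ {K} → ConceptsContaining S K × y I₀ i₀ j₀ ∈ʸ K → Consistent s I₀ (replicate r ∅) K
    empty-consistent (_ , (_ , I₀≡I)) = sym I₀≡I , λ i x∈∅ → ⊥-elim (∉⊥ (subst (_ ∈ˢ_) (lookup-replicate i ∅) x∈∅))
  ... | K , (S⊆K , _) , Q , (_ , Q⊆oriented) , d+0≤size =
    τ H , passes⇒∈ (τ H) (containing⇒passes S K S⊆K) , (begin
    2 * d                              ≤⟨ *-monoʳ-≤ 2 (≤-trans (m≤m+n d _) d+0≤size) ⟩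
    2 * size Q                         ≤⟨ 2*size≤ Q s (τ H) rows ⟩
    r * k + k * agreements s (τ H)     ∎)
    where
    H = Concept.cH K
    rows : ∀ i → 2 * ∣ lookup Q i ∣ ≤ k + k * [ not (lookup s i xor lookup (τ H) i) ]
    rows i = subst (λ g → 2 * ∣ lookup Q i ∣ ≤ k + k * [ not (lookup s i xor g) ])
                   (sym (lookup∘tabulate (λ i → majority (lookup H i)) i))
                   (≤-trans (*-monoʳ-≤ 2 (p⊆q⇒∣p∣≤∣q∣ (Q⊆oriented i))) (2*∣oriented∣≤ (lookup s i) (lookup H i)))

BoundLS-0 : ∀ r k h → BoundLS r k h 0
BoundLS-0 r k h a b _ premise = ⊥-elim (n≮0 (subst ((2000 * k * a) ^ 2 * r <_)
  (trans (cong (λ x → (b * x) ^ 2) (0∸n≡0 (3 * r * k))) (cong (_^ 2) (*-zeroʳ b))) premise))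

lemma29 : (c : Construction) → Constr.Valid c →
    (S : List (Constr.XElem c)) → Constr.NonRepetitive c S →
    (Hs : List (Subset (Construction.r c))) → Unique Hs →
    (∀ H̃ → (H̃ ∈ Hs → Constr.Passes c S H̃) × (Constr.Passes c S H̃ → H̃ ∈ Hs)) →
    ∀ d (t : Tree (Constr.YElem c) d) →
    Shatters (Constr._∈ʸ_ c) (Constr.ConceptsContaining c S) t →
    BoundLS (Construction.r c) (Construction.k c) (length Hs) d
lemma29 c _ S _ Hs _ passes⇔ zero    leaf _ = BoundLS-0 (Construction.r c) (Construction.k c) (length Hs)
lemma29 c _ S _ Hs _ passes⇔ (suc d) (node (Constr.y I₀ i₀ j₀) _ t₁) (_ , sh₁) =
  ls-bound (>-nonZero⁻¹ r {{nonZeroIndex i₀}}) (>-nonZero⁻¹ k {{nonZeroIndex j₀}}) (∈-length (G∈Hs s₀))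
           (agreements≤n s₀ (G s₀)) (proj₂ (proj₂ (agreeing s₀)))
           (λ p q p≤q → Weight.covering-bound p q p≤q Hs G G∈Hs _ s₀-minimal)
  where
  open Construction c using (r; k)
  agreeing = Adversary.agreeing-member c S Hs (λ H̃ → proj₂ (passes⇔ H̃)) t₁ I₀ i₀ j₀ sh₁
  G : Subset r → Subset r
  G s = proj₁ (agreeing s)
  G∈Hs : ∀ s → G s ∈ Hs
  G∈Hs s = proj₁ (proj₂ (agreeing s))
  s₀ = proj₁ (minimiser (λ s → agreements s (G s)))
  s₀-minimal = proj₂ (minimiser (λ s → agreements s (G s)))
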